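{- Let $S=(X^t,X^s,T,\prec,M)$ be a $T_0$ and DM-compact dynamic mereotopological space. Then $S$ is a trivial DMS (i.e. $T=\{t_0\}$ is a singleton and $t_0\prec t_0$) if and only if $S^+$ is a trivial DCA (i.e. for all $a,b\in M$, $a\neq\emptyset$ and $b\neq\emptyset$ imply $aC^tb$ and $a\mathcal{B}b$).
   Context: A DMS is $S=(X^t,X^s,T,\prec,M)$ with $X^t$ a nonempty topological space, $M$ a Boolean subalgebra of the regular closed sets $RC(X^t)$ forming a closed base, $X^s,T$ nonempty subsets of $X^t$, every nonempty regular closed set meets $X^s$, $\prec$ a binary relation on $X^t$; on $M$: $aC^tb$ iff $a\cap b\neq\emptyset$, $aC^sb$ iff $a\cap b\cap X^s\neq\emptyset$, $a\mathcal{B}b$ iff $\exists x\in a,y\in b\,(x\prec y)$; $S^+=(M,C^s,C^t,\mathcal{B})$; $\rho_S(x)=\{a\in M:x\in a\}$. Axioms: $S^+$ is a dynamic contact algebra (Boolean algebra with $0\neq1$, contact relations $C^s\subseteq C^t$, precontact $\mathcal{B}$, $a\overline{C^t}b\Rightarrow\exists c(a\overline{C^t}c\wedge c^*\overline{C^t}b)$, $a\overline{\mathcal{B}}b\Rightarrow\exists c(a\overline{C^t}c\wedge c^*\overline{\mathcal{B}}b)$, $a\overline{\mathcal{B}}b\Rightarrow\exists c(a\overline{\mathcal{B}}c\wedge c^*\overline{C^t}b)$); $x\prec y$ iff $\forall a,b\in M(x\in a,y\in b\Rightarrow a\mathcal{B}b)$; $\rho_S(x)$ is a cluster of $S^+$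 for $x\in T$. t-clans/s-clans: $\Gamma$ with $1\in\Gamma,0\notin\Gamma$, upward closed, prime, pairwise $C^t$-/$C^s$-related; clusters: t-clans with $\forall a\notin\Gamma\exists b\in\Gamma\,a\overline{C^t}b$. $T_0$: $X^t$ is $T_0$. DM-compact: every t-clan, s-clan, cluster of $S^+$ equals $\rho_S(x)$ for some $x$ in $X^t$, $X^s$, $T$ respectively. -}

module Defs where

open import Data.Product using (Σ; ∃; _×_; _,_)
open import Data.Sum using (_⊎_)
open import Data.Empty using (⊥)
open import Data.Unit using (⊤)
open import Relation.Nullary using (¬_; Dec)
open import Relation.Binary.PropositionalEquality using (_≡_)

Subset : Set → Set₁
Subset X = X → Set

module _ {X : Set} where
  infix 4 _⊆_ _≐_
  infixr 7 _∩_
  infixr 6 _∪_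

  _⊆_ : Subset X → Subset X → Set
  A ⊆ B = ∀ {x} → A x → B x

  _≐_ : Subset X → Subset X → Set
  A ≐ B = (A ⊆ B) × (B ⊆ A)

  ∅ : Subset X
  ∅ _ = ⊥

  full : Subset X
  full _ = ⊤

  _∩_ : Subset X → Subset X → Subset X
  (A ∩ B) x = A x × B x

  _∪_ : Subset X → Subset X → Subset X
  (A ∪ B) x = A x ⊎ B x

  ∁ : Subset X → Subset X
  ∁ A x = ¬ A x

  Nonempty : Subset X → Set
  Nonempty A = ∃ λ x → A x

_⇔_ : Set → Set → Set
P ⇔ Q = (P → Q) × (Q → P)

-- The open sets are given as a family indexed by a
-- type Open (so that quantifying over open sets stays in Set); the
-- collection of open sets is closed under ≐, contains the whole space,
-- binary intersections and arbitrary (Set-indexed) unions.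

record TopSpace : Set₁ where
  field
    Carrier : Set
    Open    : Set
    ⟦_⟧ₒ    : Open → Subset Carrier
    open-full : Σ Open λ o → ⟦ o ⟧ₒ ≐ full
    open-∩    : (o₁ o₂ : Open) → Σ Open λ o → ⟦ o ⟧ₒ ≐ (⟦ o₁ ⟧ₒ ∩ ⟦ o₂ ⟧ₒ)
    open-⋃    : (I : Set) (f : I → Open) →
                Σ Open λ o → ⟦ o ⟧ₒ ≐ (λ x → Σ I λ i → ⟦ f i ⟧ₒ x)

  IsOpen : Subset Carrier → Set
  IsOpen U = Σ Open λ o → ⟦ o ⟧ₒ ≐ U

  IsClosed : Subset Carrier → Set
  IsClosed F = IsOpen (∁ F)

  int : Subset Carrier → Subset Carrier
  int A x = Σ Open λ o → ⟦ o ⟧ₒ x × (⟦ o ⟧ₒ ⊆ A)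

  cl : Subset Carrier → Subset Carrier
  cl A x = (o : Open) → ⟦ o ⟧ₒ x → Nonempty (⟦ o ⟧ₒ ∩ A)

  RegClosed : Subset Carrier → Set
  RegClosed A = A ≐ cl (int A)

  _·ʳᶜ_ : Subset Carrier → Subset Carrier → Subset Carrier
  A ·ʳᶜ B = cl (int (A ∩ B))

  _*ʳᶜ : Subset Carrier → Subset Carrier
  A *ʳᶜ = cl (∁ A)

  IsT₀ : Set
  IsT₀ = (x y : Carrier) → ((o : Open) → ⟦ o ⟧ₒ x ⇔ ⟦ o ⟧ₒ y) → x ≡ y

-- M is given as a family of subsets of Xᵗ indexed by a type M; two
-- indices denote the same element of M iff their sets are ≐.

record DMSData : Set₁ where
  field
    Xᵗ  : TopSpace
  open TopSpace Xᵗ public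
  field
    Xˢ  : Subset Carrier
    T   : Subset Carrier
    _≺_ : Carrier → Carrier → Set
    M   : Set
    ⟦_⟧ : M → Subset Carrier

  Cᵗ : Subset Carrier → Subset Carrier → Set
  Cᵗ A B = Nonempty (A ∩ B)

  Cˢ : Subset Carrier → Subset Carrier → Set
  Cˢ A B = Nonempty (A ∩ B ∩ Xˢ)

  𝓑 : Subset Carrier → Subset Carrier → Set
  𝓑 A B = Σ Carrier λ x → Σ Carrier λ y → A x × B y × (x ≺ y)

  NonZero : M → Set
  NonZero a = ¬ (⟦ a ⟧ ≐ ∅)

  ρ : Carrier → M → Set
  ρ x a = ⟦ a ⟧ x

  record IsBooleanSubalgebraBase : Set₁ where
    field
      regClosed : (a : M) → RegClosed ⟦ a ⟧
      has-0     : Σ M λ c → ⟦ c ⟧ ≐ ∅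
      has-1     : Σ M λ c → ⟦ c ⟧ ≐ full
      has-+     : (a b : M) → Σ M λ c → ⟦ c ⟧ ≐ (⟦ a ⟧ ∪ ⟦ b ⟧)
      has-·     : (a b : M) → Σ M λ c → ⟦ c ⟧ ≐ (⟦ a ⟧ ·ʳᶜ ⟦ b ⟧)
      has-*     : (a : M) → Σ M λ c → ⟦ c ⟧ ≐ (⟦ a ⟧ *ʳᶜ)
      closedBase : (F : Subset Carrier) → IsClosed F →
                   Σ (M → Set) λ P → F ≐ (λ x → (a : M) → P a → ⟦ a ⟧ x)

  -- contact relation axioms (on M, with the operations of RC(Xᵗ);
  -- 0 of M is ∅ and a + b is ⟦a⟧ ∪ ⟦b⟧)
  record IsContact (C : Subset Carrier → Subset Carrier → Set) : Set where
    field
      C-nz   : (a b : M) → C ⟦ a ⟧ ⟦ b ⟧ → NonZero a × NonZero b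
      C-refl : (a : M) → NonZero a → C ⟦ a ⟧ ⟦ a ⟧
      C-sym  : (a b : M) → C ⟦ a ⟧ ⟦ b ⟧ → C ⟦ b ⟧ ⟦ a ⟧
      C-+    : (a b c : M) → C ⟦ a ⟧ (⟦ b ⟧ ∪ ⟦ c ⟧) ⇔ (C ⟦ a ⟧ ⟦ b ⟧ ⊎ C ⟦ a ⟧ ⟦ c ⟧)

  record IsPrecontact (C : Subset Carrier → Subset Carrier → Set) : Set where
    field
      P-nz  : (a b : M) → C ⟦ a ⟧ ⟦ b ⟧ → NonZero a × NonZero b
      P-+ʳ  : (a b c : M) → C ⟦ a ⟧ (⟦ b ⟧ ∪ ⟦ c ⟧) ⇔ (C ⟦ a ⟧ ⟦ b ⟧ ⊎ C ⟦ a ⟧ ⟦ c ⟧)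
      P-+ˡ  : (a b c : M) → C (⟦ a ⟧ ∪ ⟦ b ⟧) ⟦ c ⟧ ⇔ (C ⟦ a ⟧ ⟦ c ⟧ ⊎ C ⟦ b ⟧ ⟦ c ⟧)

  -- S⁺ = (M, Cˢ, Cᵗ, 𝓑) is a dynamic contact algebra.
  -- (The Boolean algebra laws hold since M is a Boolean subalgebra of
  -- RC(Xᵗ); 0 ≠ 1 is stated explicitly.)
  record IsDCA : Set where
    field
      zero≢one : ¬ (∅ ≐ full {Carrier})
      Cᵗ-contact : IsContact Cᵗ
      Cˢ-contact : IsContact Cˢ
      Cˢ⊆Cᵗ      : (a b : M) → Cˢ ⟦ a ⟧ ⟦ b ⟧ → Cᵗ ⟦ a ⟧ ⟦ b ⟧
      𝓑-precontact : IsPrecontact 𝓑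
      ext-Cᵗ : (a b : M) → ¬ Cᵗ ⟦ a ⟧ ⟦ b ⟧ →
               Σ M λ c → ¬ Cᵗ ⟦ a ⟧ ⟦ c ⟧ × ¬ Cᵗ (⟦ c ⟧ *ʳᶜ) ⟦ b ⟧
      ext-𝓑₁ : (a b : M) → ¬ 𝓑 ⟦ a ⟧ ⟦ b ⟧ →
               Σ M λ c → ¬ Cᵗ ⟦ a ⟧ ⟦ c ⟧ × ¬ 𝓑 (⟦ c ⟧ *ʳᶜ) ⟦ b ⟧
      ext-𝓑₂ : (a b : M) → ¬ 𝓑 ⟦ a ⟧ ⟦ b ⟧ →
               Σ M λ c → ¬ 𝓑 ⟦ a ⟧ ⟦ c ⟧ × ¬ Cᵗ (⟦ c ⟧ *ʳᶜ) ⟦ b ⟧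

  record IsClan (C : Subset Carrier → Subset Carrier → Set) (Γ : M → Set) : Set where
    field
      one∈   : (a : M) → ⟦ a ⟧ ≐ full → Γ a
      zero∉  : (a : M) → ⟦ a ⟧ ≐ ∅ → ¬ Γ a
      upward : (a b : M) → Γ a → ⟦ a ⟧ ⊆ ⟦ b ⟧ → Γ b
      prime  : (a b c : M) → ⟦ c ⟧ ≐ (⟦ a ⟧ ∪ ⟦ b ⟧) → Γ c → Γ a ⊎ Γ b
      pairwise : (a b : M) → Γ a → Γ b → C ⟦ a ⟧ ⟦ b ⟧

  IsTClan : (M → Set) → Set
  IsTClan = IsClan Cᵗ

  IsSClan : (M → Set) → Set
  IsSClan = IsClan Cˢ

  IsCluster : (M → Set) → Set
  IsCluster Γ = IsTClan Γ × ((a : M) → ¬ Γ a → Σ M λ b → Γ b × ¬ Cᵗ ⟦ a ⟧ ⟦ b ⟧)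

  _≡ρ_ : (M → Set) → Carrier → Set
  Γ ≡ρ x = (a : M) → Γ a ⇔ ρ x a

  record IsDMS : Set₁ where
    field
      Xᵗ-nonempty : Nonempty {Carrier} full
      Xˢ-nonempty : Nonempty Xˢ
      T-nonempty  : Nonempty T
      boolBase    : IsBooleanSubalgebraBase
      rc-meets-Xˢ : (A : Subset Carrier) → RegClosed A → Nonempty A → Nonempty (A ∩ Xˢ)
      S⁺-DCA      : IsDCA
      ≺-char      : (x y : Carrier) → (x ≺ y) ⇔ ((a b : M) → ⟦ a ⟧ x → ⟦ b ⟧ y → 𝓑 ⟦ a ⟧ ⟦ b ⟧)
      ρ-cluster   : (x : Carrier) → T x → IsCluster (ρ x)

  DMCompact : Set₁
  DMCompact =
      ((Γ : M → Set) → IsTClan Γ → Σ Carrier λ x → Γ ≡ρ x)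
    × ((Γ : M → Set) → IsSClan Γ → Σ Carrier λ x → Xˢ x × Γ ≡ρ x)
    × ((Γ : M → Set) → IsCluster Γ → Σ Carrier λ x → T x × Γ ≡ρ x)

  TrivialDMS : Set
  TrivialDMS = Σ Carrier λ t₀ → ((x : Carrier) → T x ⇔ (x ≡ t₀)) × (t₀ ≺ t₀)

  TrivialDCA : Set
  TrivialDCA = (a b : M) → NonZero a → NonZero b → Cᵗ ⟦ a ⟧ ⟦ b ⟧ × 𝓑 ⟦ a ⟧ ⟦ b ⟧

-- classical metatheory (the paper reasons classically)
ExcludedMiddle : Set₁
ExcludedMiddle = (P : Set) → Dec P

-- Given a point x, the elements of M that meet every element having x in its
-- interior form a cluster containing every element that contains x.  Under
-- DM-compactness this cluster is ρ(t) for some t ∈ T; so if T = {t₀}, every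
-- nonzero element contains t₀, and t₀ ≺ t₀ makes any two of them Cᵗ- and
-- 𝓑-related.  Conversely, if S⁺ is trivial then each t ∈ T lies in every
-- nonzero a: otherwise the cluster ρ(t) contains some b with ¬ a Cᵗ b.  Hence
-- all points of T have the same ρ, and as M is a closed base they have the
-- same neighbourhoods, so T₀ forces T to be a singleton; x ≺ y for all x, y
-- follows from the characterisation of ≺.

module Submission where

open import Defs
open import Data.Product using (Σ; _×_; _,_; proj₁; proj₂)
open import Data.Sum using (_⊎_; inj₁; inj₂)
open import Data.Empty using (⊥-elim)
open import Data.Unit using (tt)
open import Relation.Nullary using (¬_; yes; no)
open import Relation.Nullary.Decidable using (decidable-stable)
open import Relation.Binary.PropositionalEquality using (_≡_; refl; subst)

module Classical (em : ExcludedMiddle) where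

  dne : {P : Set} → ¬ ¬ P → P
  dne {P} = decidable-stable (em P)

  ¬∀⟶∃¬ : {A : Set} {B : A → Set} → ¬ ((a : A) → B a) → Σ A λ a → ¬ B a
  ¬∀⟶∃¬ ¬∀ = dne λ ¬∃ → ¬∀ λ a → dne λ ¬b → ¬∃ (a , ¬b)

  ¬→⟶×¬ : {P Q : Set} → ¬ (P → Q) → P × ¬ Q
  ¬→⟶×¬ ¬p→q = dne (λ ¬p → ¬p→q λ p → ⊥-elim (¬p p)) , λ q → ¬p→q λ _ → q

module Topology (X : TopSpace) where
  open TopSpace X

  module _ {A B : Subset Carrier} where

    int-mono : A ⊆ B → int A ⊆ int B
    int-mono A⊆B (o , xo , o⊆A) = o , xo , λ zo → A⊆B (o⊆A zo)

    cl-mono : A ⊆ B → cl A ⊆ cl B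
    cl-mono A⊆B x∈clA o xo with x∈clA o xo
    ... | z , zo , zA = z , zo , A⊆B zA

    int-∩ : ∀ {x} → int A x → int B x → int (A ∩ B) x
    int-∩ (o₁ , xo₁ , o₁⊆A) (o₂ , xo₂ , o₂⊆B) with open-∩ o₁ o₂
    ... | o , o≐o₁∩o₂ = o , proj₂ o≐o₁∩o₂ (xo₁ , xo₂) , λ zo →
          let (zo₁ , zo₂) = proj₁ o≐o₁∩o₂ zo in o₁⊆A zo₁ , o₂⊆B zo₂

  module _ {A : Subset Carrier} where

    int⊆ : int A ⊆ A
    int⊆ (o , xo , o⊆A) = o⊆A xo

    ⊆cl : A ⊆ cl A
    ⊆cl {x} xA o xo = x , xo , xA

    int⊆int-int : int A ⊆ int (int A)
    int⊆int-int (o , xo , o⊆A) = o , xo , λ zo → o , zo , o⊆A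

  int-full : ∀ {x} → int full x
  int-full with open-full
  ... | o , o≐full = o , proj₂ o≐full tt , λ _ → tt

  ·ʳᶜ-⊆ˡ : {A B : Subset Carrier} → RegClosed A → (A ·ʳᶜ B) ⊆ A
  ·ʳᶜ-⊆ˡ A-rc z∈A·B = proj₂ A-rc (cl-mono (int-mono proj₁) z∈A·B)

  ·ʳᶜ-⊆ʳ : {A B : Subset Carrier} → RegClosed B → (A ·ʳᶜ B) ⊆ B
  ·ʳᶜ-⊆ʳ B-rc z∈A·B = proj₂ B-rc (cl-mono (int-mono proj₂) z∈A·B)

  int-·ʳᶜ : ∀ {A B x} → int A x → int B x → int (A ·ʳᶜ B) x
  int-·ʳᶜ x∈°A x∈°B = int-mono ⊆cl (int⊆int-int (int-∩ x∈°A x∈°B))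

module ClassicalTopology (em : ExcludedMiddle) (X : TopSpace) where
  open TopSpace X
  open Classical em

  ¬cl∁⟶int : ∀ {A x} → ¬ cl (∁ A) x → int A x
  ¬cl∁⟶int ¬x∈cl∁A with ¬∀⟶∃¬ ¬x∈cl∁A
  ... | o , ¬[xo→o∩∁A] with ¬→⟶×¬ ¬[xo→o∩∁A]
  ... | xo , o∩∁A=∅ = o , xo , λ {z} zo → dne λ ¬Az → o∩∁A=∅ (z , zo , ¬Az)

  ∁-open-isClosed : (o : Open) → IsClosed (∁ ⟦ o ⟧ₒ)
  ∁-open-isClosed o = o , (λ xo ¬xo → ¬xo xo) , dne

module DMS (em : ExcludedMiddle) (S : DMSData) (dms : DMSData.IsDMS S) where
  open DMSData S
  open IsDMS dms
  open IsBooleanSubalgebraBase boolBase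
  open IsDCA S⁺-DCA
  open Classical em
  open Topology Xᵗ
  open ClassicalTopology em Xᵗ

  nonZero-intro : ∀ {a x} → ⟦ a ⟧ x → NonZero a
  nonZero-intro xa a≐∅ = proj₁ a≐∅ xa

  nonZero⇒nonempty : (a : M) → NonZero a → Nonempty ⟦ a ⟧
  nonZero⇒nonempty a a≠0 = dne λ a=∅ → a≠0 ((λ {z} za → a=∅ (z , za)) , λ ())

  clusterAt : Carrier → M → Set
  clusterAt x c = (d : M) → int ⟦ d ⟧ x → Cᵗ ⟦ c ⟧ ⟦ d ⟧

  ρ⊆clusterAt : ∀ {x} → ρ x ⊆ clusterAt x
  ρ⊆clusterAt {x} xc d x∈°d = x , xc , int⊆ x∈°d

  ∉clusterAt : ∀ {x c} → ¬ clusterAt x c → Σ M λ d → int ⟦ d ⟧ x × ¬ Cᵗ ⟦ c ⟧ ⟦ d ⟧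
  ∉clusterAt ¬γ with ¬∀⟶∃¬ ¬γ
  ... | d , ¬[x∈°d→c∩d] = d , ¬→⟶×¬ ¬[x∈°d→c∩d]

  -- ext-Cᵗ separates c from f by some g with x ∉ g*, i.e. with x ∈ int g.
  clusterAt-meets : ∀ {x c f} → clusterAt x c → ⟦ f ⟧ x → Cᵗ ⟦ c ⟧ ⟦ f ⟧
  clusterAt-meets {x} {c} {f} γ xf = dne λ c∌f →
    let (g , c∌g , g*∌f) = ext-Cᵗ c f c∌f in
    c∌g (γ g (¬cl∁⟶int λ x∈g* → g*∌f (x , x∈g* , xf)))

  clusterAt-¬¬pairwise : ∀ {x} a b → clusterAt x a → clusterAt x b → ¬ ¬ Cᵗ ⟦ a ⟧ ⟦ b ⟧
  clusterAt-¬¬pairwise {x} a b γa γb a∌b with ext-Cᵗ a b a∌b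
  ... | e , a∌e , e*∌b with em (⟦ e ⟧ x) | has-* e
  ... | yes xe | _ = a∌e (clusterAt-meets γa xe)
  ... | no x∉e | e* , e*≐ with clusterAt-meets γb (proj₂ e*≐ (⊆cl x∉e))
  ... | z , zb , ze* = e*∌b (z , proj₁ e*≐ ze* , zb)

  clusterAt-∪ : ∀ {x} a b c → ⟦ c ⟧ ⊆ (⟦ a ⟧ ∪ ⟦ b ⟧) →
                ¬ clusterAt x a → ¬ clusterAt x b → ¬ clusterAt x c
  clusterAt-∪ a b c c⊆a∪b ¬γa ¬γb γc with ∉clusterAt ¬γa | ∉clusterAt ¬γb
  ... | d₁ , x∈°d₁ , a∌d₁ | d₂ , x∈°d₂ , b∌d₂ with has-· d₁ d₂
  ... | d , d≐d₁·d₂ with γc d (int-mono (proj₂ d≐d₁·d₂) (int-·ʳᶜ x∈°d₁ x∈°d₂))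
  ... | z , zc , zd with c⊆a∪b zc
  ... | inj₁ za = a∌d₁ (z , za , ·ʳᶜ-⊆ˡ (regClosed d₁) (proj₁ d≐d₁·d₂ zd))
  ... | inj₂ zb = b∌d₂ (z , zb , ·ʳᶜ-⊆ʳ (regClosed d₂) (proj₁ d≐d₁·d₂ zd))

  clusterAt-isTClan : (x : Carrier) → IsTClan (clusterAt x)
  clusterAt-isTClan x = record
    { one∈     = λ a a≐full → ρ⊆clusterAt (proj₂ a≐full tt)
    ; zero∉    = zero∉
    ; upward   = λ a b γa a⊆b d x∈°d →
                   let (z , za , zd) = γa d x∈°d in z , a⊆b za , zd
    ; prime    = prime
    ; pairwise = λ a b γa γb → dne (clusterAt-¬¬pairwise a b γa γb)
    }
    where
    zero∉ : (a : M) → ⟦ a ⟧ ≐ ∅ → ¬ clusterAt x a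
    zero∉ a a≐∅ γa with has-1
    ... | one , one≐full with γa one (int-mono (proj₂ one≐full) int-full)
    ... | z , za , _ = proj₁ a≐∅ za

    prime : (a b c : M) → ⟦ c ⟧ ≐ (⟦ a ⟧ ∪ ⟦ b ⟧) → clusterAt x c →
            clusterAt x a ⊎ clusterAt x b
    prime a b c c≐a∪b γc with em (clusterAt x a) | em (clusterAt x b)
    ... | yes γa | _      = inj₁ γa
    ... | no _   | yes γb = inj₂ γb
    ... | no ¬γa | no ¬γb = ⊥-elim (clusterAt-∪ a b c (proj₁ c≐a∪b) ¬γa ¬γb γc)

  clusterAt-isCluster : (x : Carrier) → IsCluster (clusterAt x)
  clusterAt-isCluster x = clusterAt-isTClan x , λ a ¬γa →
    let (d , x∈°d , a∌d) = ∉clusterAt ¬γa in d , ρ⊆clusterAt (int⊆ x∈°d) , a∌d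

  nonZero-meets-T : DMCompact → (a : M) → NonZero a → Σ Carrier λ t → T t × ⟦ a ⟧ t
  nonZero-meets-T (_ , _ , cluster-compact) a a≠0 =
    let (x , xa) = nonZero⇒nonempty a a≠0
        (t , Tt , clusterAt-x≡ρt) = cluster-compact (clusterAt x) (clusterAt-isCluster x)
    in t , Tt , proj₁ (clusterAt-x≡ρt a) (ρ⊆clusterAt xa)

  trivialDMS⇒trivialDCA : DMCompact → TrivialDMS → TrivialDCA
  trivialDMS⇒trivialDCA dmc (t₀ , T≡t₀ , t₀≺t₀) a b a≠0 b≠0 =
    (t₀ , t₀∈ a a≠0 , t₀∈ b b≠0) , (t₀ , t₀ , t₀∈ a a≠0 , t₀∈ b b≠0 , t₀≺t₀)
    where
    t₀∈ : (c : M) → NonZero c → ⟦ c ⟧ t₀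
    t₀∈ c c≠0 with nonZero-meets-T dmc c c≠0
    ... | t , Tt , tc = subst ⟦ c ⟧ (proj₁ (T≡t₀ t) Tt) tc

  trivialDCA⇒T⊆nonZero : TrivialDCA → ∀ {x} → T x → (a : M) → NonZero a → ⟦ a ⟧ x
  trivialDCA⇒T⊆nonZero triv {x} Tx a a≠0 = dne λ x∉a →
    let (b , xb , a∌b) = proj₂ (ρ-cluster x Tx) a x∉a in
    a∌b (proj₁ (triv a b a≠0 (nonZero-intro xb)))

  trivialDCA⇒≺ : TrivialDCA → (x y : Carrier) → x ≺ y
  trivialDCA⇒≺ triv x y = proj₂ (≺-char x y) λ a b xa yb →
    proj₂ (triv a b (nonZero-intro xa) (nonZero-intro yb))

  ρ-reflects-opens : ∀ {x y} → ρ y ⊆ ρ x → (o : Open) → ⟦ o ⟧ₒ x → ⟦ o ⟧ₒ y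
  ρ-reflects-opens {x} {y} ρy⊆ρx o xo = dne λ y∉o →
    let (P , ∁o≐⋂P) = closedBase (∁ ⟦ o ⟧ₒ) (∁-open-isClosed o)
        (a , Pa→xa) = ¬∀⟶∃¬ λ x∈⋂P → proj₂ ∁o≐⋂P x∈⋂P xo
        (Pa , x∉a) = ¬→⟶×¬ Pa→xa
    in x∉a (ρy⊆ρx (proj₁ ∁o≐⋂P y∉o a Pa))

  ρ-injective : IsT₀ → ∀ {x y} → ρ x ≐ ρ y → x ≡ y
  ρ-injective t₀ {x} {y} (ρx⊆ρy , ρy⊆ρx) =
    t₀ x y λ o → ρ-reflects-opens ρy⊆ρx o , ρ-reflects-opens ρx⊆ρy o

  trivialDCA⇒trivialDMS : IsT₀ → TrivialDCA → TrivialDMS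
  trivialDCA⇒trivialDMS t₀ triv with T-nonempty
  ... | t , Tt = t , (λ x → T⇒≡t x , λ { refl → Tt }) , trivialDCA⇒≺ triv t t
    where
    ρ-const-on-T : ∀ {x y} → T x → T y → ρ x ⊆ ρ y
    ρ-const-on-T _ Ty {a} xa = trivialDCA⇒T⊆nonZero triv Ty a (nonZero-intro xa)

    T⇒≡t : (x : Carrier) → T x → x ≡ t
    T⇒≡t x Tx = ρ-injective t₀ (ρ-const-on-T Tx Tt , ρ-const-on-T Tt Tx)

lemma5p29 : ExcludedMiddle → (S : DMSData) → DMSData.IsDMS S →
    TopSpace.IsT₀ (DMSData.Xᵗ S) → DMSData.DMCompact S →
    DMSData.TrivialDMS S ⇔ DMSData.TrivialDCA S
lemma5p29 em S dms t₀ dmc =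
  DMS.trivialDMS⇒trivialDCA em S dms dmc , DMS.trivialDCA⇒trivialDMS em S dms t₀
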